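{- Let $v\in\mathbb{N}$ and let $B_1=\langle r_0,\dots,r_{k-1}\rangle$ and $B_2=\langle r'_0,\dots,r'_{k-2}\rangle$ be bases such that, for some position $0\le p<k-1$: $r'_i=r_i$ for $0\le i<p$, $r'_p=r_p\cdot r_{p+1}$, and $r'_i=r_{i+1}$ for $p<i<k-1$. Then the sum of the digits of $v_{(B_2)}$ is greater than or equal to the sum of the digits of $v_{(B_1)}$.
   Context: A base is a finite sequence $B=\langle r_0,\dots,r_{k-1}\rangle$ of integers $r_i>1$, with weights $w_0=1$, $w_{i+1}=w_ir_i$. The representation $v_{(B)}=\langle d_0,\dots,d_k\rangle$ of a natural number $v$ in $B$ is the unique tuple of $k+1$ natural numbers with $0\le d_i<r_i$ for $i<k$ (no bound on $d_k$) and $v=\sum_{i=0}^k d_iw_i$; its sum of digits is $\sum_{i=0}^k d_i$. -}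

module Defs where

open import Data.Nat using (ℕ; zero; suc; _+_; _*_; _<_; _≤_)
open import Data.Vec using (Vec; []; _∷_; lookup; sum)
open import Data.Vec.Relation.Unary.All using (All)
open import Data.Fin using (Fin; toℕ)
open import Data.Product using (_×_)

IsBase : {k : ℕ} → Vec ℕ k → Set
IsBase B = All (λ r → 1 < r) B

-- weights: w_0 = 1, w_{i+1} = w_i * r_i
-- value of a digit tuple ⟨d_0,…,d_k⟩ in base ⟨r_0,…,r_{k-1}⟩ :
--   d_0 * 1 + r_0 * (value of ⟨d_1,…,d_k⟩ in ⟨r_1,…,r_{k-1}⟩)
-- which equals Σ d_i w_i.
value : {k : ℕ} → Vec ℕ k → Vec ℕ (suc k) → ℕ
value []      (d ∷ []) = d
value (r ∷ B) (d ∷ ds) = d + r * value B ds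

-- digit bounds: 0 ≤ d_i < r_i for i < k, no bound on d_k
DigitsBounded : {k : ℕ} → Vec ℕ k → Vec ℕ (suc k) → Set
DigitsBounded B ds = (i : Fin _) → lookup ds (Data.Fin.inject₁ i) < lookup B i

IsRepresentation : {k : ℕ} → Vec ℕ k → ℕ → Vec ℕ (suc k) → Set
IsRepresentation B v ds = DigitsBounded B ds × (value B ds ≡ v)
  where open import Relation.Binary.PropositionalEquality using (_≡_)

digitSum : {k : ℕ} → Vec ℕ k → ℕ
digitSum = sum

module Submission where

-- Write merge B p for the base obtained from B by replacing the radices
-- r_p, r_{p+1} with their product.  The proof rests on uniqueness of
-- representations, which reduces to uniqueness of division with remainder
-- (digit-unique).  The three hypotheses of the theorem say exactly that
-- B₂ = merge B₁ p (merge-characterised).  Then, by induction on p: below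
-- position p both bases share their radices, so both representations share
-- their lowest digit; at position p the digits a, b of v in ⟨r₀, r₁, …⟩ and
-- the digit c of v in ⟨r₀ r₁, …⟩ satisfy c = a + r₀ b with identical higher
-- digits (merge-head), and a + b ≤ a + r₀ b because r₀ > a ≥ 0.

open import Defs
open import Data.Nat using (ℕ; suc; _+_; _*_; _≤_; _<_; s≤s; z≤n; NonZero; >-nonZero)
open import Data.Nat.Properties
  using (≤-<-trans; *-comm; *-cancelˡ-≡; +-cancelˡ-≡; +-monoˡ-<; *-suc; *-monoʳ-≤; +-assoc;
         +-monoˡ-≤; +-monoʳ-≤; m≤n*m; module ≤-Reasoning)
open import Data.Nat.DivMod using (_%_; [m+kn]%n≡m%n; m<n⇒m%n≡m)
open import Data.Nat.Solver using (module +-*-Solver)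
open import Data.Vec using (Vec; lookup; []; _∷_; sum)
open import Data.Vec.Relation.Binary.Pointwise.Extensional using (ext; Pointwise-≡⇒≡)
open import Data.Fin using (Fin; toℕ; inject₁)
open import Data.Fin as F using ()
open import Data.Fin.Properties using (<-cmp)
open import Data.Product using (_×_; _,_)
open import Relation.Binary.Definitions using (tri<; tri≈; tri>)
open import Relation.Binary.PropositionalEquality

radix-nonZero : ∀ {d r} → d < r → NonZero r
radix-nonZero d<r = >-nonZero (≤-<-trans z≤n d<r)

digit-unique : ∀ {r a c X Y} → a < r → c < r → a + r * X ≡ c + r * Y → a ≡ c × X ≡ Y
digit-unique {r} {a} {c} {X} {Y} a<r c<r eq = a≡c , X≡Y
  where
  instance
    r≢0 : NonZero r
    r≢0 = radix-nonZero a<r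

  remainder : ∀ {d Z} → d < r → (d + r * Z) % r ≡ d
  remainder {d} {Z} d<r = begin
    (d + r * Z) % r  ≡⟨ cong (λ t → (d + t) % r) (*-comm r Z) ⟩
    (d + Z * r) % r  ≡⟨ [m+kn]%n≡m%n d Z r ⟩
    d % r            ≡⟨ m<n⇒m%n≡m d<r ⟩
    d                ∎
    where open ≡-Reasoning

  a≡c : a ≡ c
  a≡c = trans (sym (remainder a<r)) (trans (cong (_% r) eq) (remainder c<r))

  X≡Y : X ≡ Y
  X≡Y = *-cancelˡ-≡ X Y r (+-cancelˡ-≡ c _ _ (subst (λ d → d + r * X ≡ c + r * Y) a≡c eq))

bounded-head : ∀ {k r d} {B : Vec ℕ k} {ds} → DigitsBounded (r ∷ B) (d ∷ ds) → d < r
bounded-head bd = bd F.zero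

bounded-tail : ∀ {k r d} {B : Vec ℕ k} {ds} → DigitsBounded (r ∷ B) (d ∷ ds) → DigitsBounded B ds
bounded-tail bd i = bd (F.suc i)

representation-unique : ∀ {k} (B : Vec ℕ k) {ds es}
  → DigitsBounded B ds → DigitsBounded B es → value B ds ≡ value B es → ds ≡ es
representation-unique []      {d ∷ []} {e ∷ []} _  _  eq = cong (_∷ []) eq
representation-unique (r ∷ B) {d ∷ ds} {e ∷ es} bd be eq
  with digit-unique (bounded-head bd) (bounded-head be) eq
... | refl , tails = cong (d ∷_) (representation-unique B (bounded-tail bd) (bounded-tail be) tails)

merge : ∀ {n} → Vec ℕ (suc n) → Fin n → Vec ℕ n
merge (r₀ ∷ r₁ ∷ B) F.zero    = r₀ * r₁ ∷ B
merge (r  ∷ B)      (F.suc p) = r ∷ merge B p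

merge-below : ∀ {n} (B : Vec ℕ (suc n)) (p i : Fin n)
  → toℕ i < toℕ p → lookup (merge B p) i ≡ lookup B (inject₁ i)
merge-below (r ∷ B@(_ ∷ _)) (F.suc p) F.zero    _         = refl
merge-below (r ∷ B@(_ ∷ _)) (F.suc p) (F.suc i) (s≤s i<p) = merge-below B p i i<p

merge-at : ∀ {n} (B : Vec ℕ (suc n)) (p : Fin n)
  → lookup (merge B p) p ≡ lookup B (inject₁ p) * lookup B (F.suc p)
merge-at (r₀ ∷ r₁ ∷ B) F.zero    = refl
merge-at (r  ∷ B@(_ ∷ _)) (F.suc p) = merge-at B p

merge-above : ∀ {n} (B : Vec ℕ (suc n)) (p i : Fin n)
  → toℕ p < toℕ i → lookup (merge B p) i ≡ lookup B (F.suc i)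
merge-above (r₀ ∷ r₁ ∷ B) F.zero    (F.suc i) _         = refl
merge-above (r  ∷ B@(_ ∷ _)) (F.suc p) (F.suc i) (s≤s p<i) = merge-above B p i p<i

merge-characterised : ∀ {n} (B₁ : Vec ℕ (suc n)) (B₂ : Vec ℕ n) (p : Fin n)
  → ((i : Fin n) → toℕ i < toℕ p → lookup B₂ i ≡ lookup B₁ (inject₁ i))
  → lookup B₂ p ≡ lookup B₁ (inject₁ p) * lookup B₁ (F.suc p)
  → ((i : Fin n) → toℕ p < toℕ i → lookup B₂ i ≡ lookup B₁ (F.suc i))
  → B₂ ≡ merge B₁ p
merge-characterised B₁ B₂ p below at above = Pointwise-≡⇒≡ (ext agree)
  where
  agree : (i : Fin _) → lookup B₂ i ≡ lookup (merge B₁ p) i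
  agree i with <-cmp i p
  ... | tri< i<p _ _ = trans (below i i<p) (sym (merge-below B₁ p i i<p))
  ... | tri≈ _ refl _ = trans at (sym (merge-at B₁ p))
  ... | tri> _ _ p<i = trans (above i p<i) (sym (merge-above B₁ p i p<i))

merge-head : ∀ {k r₀ r₁} (B : Vec ℕ k) {a b c ds es}
  → DigitsBounded (r₀ ∷ r₁ ∷ B) (a ∷ b ∷ ds) → DigitsBounded (r₀ * r₁ ∷ B) (c ∷ es)
  → value (r₀ ∷ r₁ ∷ B) (a ∷ b ∷ ds) ≡ value (r₀ * r₁ ∷ B) (c ∷ es)
  → a + r₀ * b ≡ c × ds ≡ es
merge-head {r₀ = r₀} {r₁} B {a} {b} {c} {ds} {es} bd be eq
  with digit-unique merged-bound (bounded-head be) (trans (sym regroup) eq)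
  where
  open +-*-Solver using (solve; _:+_; _:*_; _:=_)

  merged-bound : a + r₀ * b < r₀ * r₁
  merged-bound = begin-strict
    a + r₀ * b   <⟨ +-monoˡ-< (r₀ * b) (bounded-head bd) ⟩
    r₀ + r₀ * b  ≡⟨ *-suc r₀ b ⟨
    r₀ * suc b   ≤⟨ *-monoʳ-≤ r₀ (bounded-head (bounded-tail bd)) ⟩
    r₀ * r₁      ∎
    where open ≤-Reasoning

  regroup : a + r₀ * (b + r₁ * value B ds) ≡ (a + r₀ * b) + (r₀ * r₁) * value B ds
  regroup = solve 5 (λ a r₀ b r₁ V → a :+ r₀ :* (b :+ r₁ :* V) := (a :+ r₀ :* b) :+ (r₀ :* r₁) :* V)
                    refl a r₀ b r₁ (value B ds)
... | digit , higher = digit , representation-unique B (bounded-tail (bounded-tail bd)) (bounded-tail be) higher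

merge-digitSum : ∀ {n} (B : Vec ℕ (suc n)) (p : Fin n) {ds es}
  → DigitsBounded B ds → DigitsBounded (merge B p) es
  → value B ds ≡ value (merge B p) es → digitSum ds ≤ digitSum es
merge-digitSum (r₀ ∷ r₁ ∷ B) F.zero {a ∷ b ∷ ds} {_ ∷ _} bd be eq
  with merge-head B bd be eq
... | refl , refl = begin
  a + (b + sum ds)       ≡⟨ +-assoc a b (sum ds) ⟨
  a + b + sum ds         ≤⟨ +-monoˡ-≤ (sum ds) (+-monoʳ-≤ a (m≤n*m b r₀)) ⟩
  a + r₀ * b + sum ds    ∎
  where
  open ≤-Reasoning
  instance
    r₀≢0 : NonZero r₀
    r₀≢0 = radix-nonZero (bounded-head bd)
merge-digitSum (r ∷ B@(_ ∷ _)) (F.suc p) {d ∷ ds} {_ ∷ es} bd be eq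
  with digit-unique (bounded-head bd) (bounded-head be) eq
... | refl , tails = +-monoʳ-≤ d (merge-digitSum B p {ds} {es} (bounded-tail bd) (bounded-tail be) tails)

proposition2 : (n : ℕ) (v : ℕ) (B₁ : Vec ℕ (suc n)) (B₂ : Vec ℕ n) (p : Fin n)
    → IsBase B₁ → IsBase B₂
    → ((i : Fin n) → toℕ i < toℕ p → lookup B₂ i ≡ lookup B₁ (inject₁ i))
    → lookup B₂ p ≡ lookup B₁ (inject₁ p) * lookup B₁ (F.suc p)
    → ((i : Fin n) → toℕ p < toℕ i → lookup B₂ i ≡ lookup B₁ (F.suc i))
    → (d₁ : Vec ℕ (suc (suc n))) → IsRepresentation B₁ v d₁
    → (d₂ : Vec ℕ (suc n)) → IsRepresentation B₂ v d₂
    → digitSum d₁ ≤ digitSum d₂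
proposition2 n v B₁ B₂ p _ _ below at above d₁ (bd₁ , val₁) d₂ (bd₂ , val₂)
  with merge-characterised B₁ B₂ p below at above
... | refl = merge-digitSum B₁ p bd₁ bd₂ (trans val₁ (sym val₂))
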